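{- Let $N,n$ be positive integers with $T_{n-1}<N<T_n$, where $T_m=m(m+1)/2$, and let $d=T_n-N$. For every unrefinable partition $\lambda=(\lambda_1,\dots,\lambda_t)$ of $N$ into distinct parts we have $n\le\lambda_t\le 2n-2$; equivalently, $\frac{\sqrt{1+8(N+d)}-1}{2}\le \lambda_t\le \sqrt{1+8(N+d)}-3$.
   Context: A partition of $N$ into distinct parts is a sequence of positive integers $\lambda_1<\lambda_2<\dots<\lambda_t$ with $t\ge 2$ and $\sum_i\lambda_i=N$; $\lambda_t$ is its maximal part. Its missing parts are the elements of $\{1,\dots,\lambda_t\}\setminus\{\lambda_1,\dots,\lambda_t\}$, listed as $\mu_1<\dots<\mu_m$. The partition is refinable if some part $\lambda_\ell$ equals $\mu_i+\mu_j$ for some $i<j$, and unrefinable otherwise. -}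

module Defs where

open import Data.Nat using (ℕ; zero; suc; _+_; _*_; _≤_; _<_)
open import Data.List using (List; []; _∷_; length; last)
open import Data.Nat.ListAction using (sum)
open import Data.List.Relation.Unary.All using (All)
open import Data.List.Relation.Unary.Linked using (Linked)
open import Data.List.Membership.Propositional using (_∈_)
open import Data.Maybe using (Maybe; just)
open import Data.Product using (_×_; ∃-syntax)
open import Relation.Nullary using (¬_)
open import Relation.Binary.PropositionalEquality using (_≡_)

T : ℕ → ℕ
T zero    = 0
T (suc m) = suc m + T m

record DistinctPartition (N : ℕ) : Set where
  field
    parts      : List ℕ
    increasing : Linked _<_ parts
    positive   : All (λ x → 1 ≤ x) parts
    atLeastTwo : 2 ≤ length parts
    sumIsN     : sum parts ≡ N

MaxPart : List ℕ → ℕ → Set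
MaxPart xs m = last xs ≡ just m

Missing : List ℕ → ℕ → ℕ → Set
Missing xs M m = (1 ≤ m) × (m ≤ M) × ¬ (m ∈ xs)

Refinable : List ℕ → Set
Refinable xs = ∃[ M ] MaxPart xs M ×
  (∃[ p ] ∃[ a ] ∃[ b ] (p ∈ xs) × Missing xs M a × Missing xs M b × (a < b) × (p ≡ a + b))

Unrefinable : List ℕ → Set
Unrefinable xs = ¬ Refinable xs

{-# OPTIONS --safe #-}
module Submission where

-- If the largest part m is at most n − 1, the parts sum to at most T (n − 1) < N.
-- If m ≥ 2n − 1, then for each 1 ≤ a ≤ n − 1 the missing-part condition forces a or m − a
-- to be a part (otherwise m = a + (m − a) refines λ); the map x ↦ min(x, m − x) sends that
-- part to a and m itself to 0, so there are at least n parts and N ≥ T n.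

open import Defs
open import Data.Nat using (ℕ; zero; suc; _+_; _*_; _∸_; _⊓_; _≤_; _<_; z≤n; s≤s; s≤s⁻¹; _≟_)
open import Data.Nat.Properties
open import Data.Nat.ListAction using (sum)
open import Data.Nat.Solver using (module +-*-Solver)
open import Data.Fin using (Fin; toℕ)
open import Data.Fin.Properties using (toℕ<n; toℕ-injective; injective⇒≤)
open import Data.List using (List; []; _∷_; length; last; lookup)
open import Data.List.Relation.Unary.All as All using (All; []; _∷_)
open import Data.List.Relation.Unary.Any using (here; there; index)
open import Data.List.Relation.Unary.Any.Properties using (lookup-index)
open import Data.List.Relation.Unary.Linked as Linked using (Linked; [-]; _∷_)
open import Data.List.Relation.Unary.Linked.Properties using (Linked⇒All)
open import Data.List.Membership.Propositional using (_∈_)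
open import Data.List.Membership.DecPropositional _≟_ using (_∈?_)
open import Data.Maybe using (just)
open import Data.Product using (_×_; _,_; proj₁; proj₂; ∃-syntax)
open import Data.Sum using (_⊎_; inj₁; inj₂)
open import Function using (_∘_)
open import Function.Definitions using (Injective)
open import Relation.Nullary using (yes; no; contradiction)
open import Relation.Binary.PropositionalEquality

T-mono-≤ : ∀ {a b} → a ≤ b → T a ≤ T b
T-mono-≤ {zero}          _         = z≤n
T-mono-≤ {suc a} {suc b} (s≤s a≤b) = +-mono-≤ (s≤s a≤b) (T-mono-≤ a≤b)

T+<⇒≤T : ∀ {a b} → a < b → T a + b ≤ T b
T+<⇒≤T {a} {suc b} (s≤s a≤b) = begin
  T a + suc b   ≡⟨ +-comm (T a) (suc b) ⟩
  suc b + T a   ≤⟨ +-monoʳ-≤ (suc b) (T-mono-≤ a≤b) ⟩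
  suc b + T b   ∎
  where open ≤-Reasoning

last-∈ : ∀ {xs : List ℕ} {m} → last xs ≡ just m → m ∈ xs
last-∈ {x ∷ []}     refl = here refl
last-∈ {x ∷ y ∷ xs} eq   = there (last-∈ {y ∷ xs} eq)

T+sum≤T-last : ∀ {x xs m} → Linked _<_ (x ∷ xs) → last (x ∷ xs) ≡ just m → T x + sum xs ≤ T m
T+sum≤T-last {x} {[]}         _           refl = ≤-reflexive (+-identityʳ (T x))
T+sum≤T-last {x} {y ∷ xs} {m} (x<y ∷ ys↑) eq   = begin
  T x + (y + sum xs)   ≡⟨ +-assoc (T x) y (sum xs) ⟨
  (T x + y) + sum xs   ≤⟨ +-monoˡ-≤ (sum xs) (T+<⇒≤T x<y) ⟩
  T y + sum xs         ≤⟨ T+sum≤T-last ys↑ eq ⟩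
  T m                  ∎
  where open ≤-Reasoning

n≤T : ∀ n → n ≤ T n
n≤T zero    = z≤n
n≤T (suc n) = m≤m+n (suc n) (T n)

sum≤T-last : ∀ {xs m} → Linked _<_ xs → last xs ≡ just m → sum xs ≤ T m
sum≤T-last {x ∷ xs} xs↑ eq = ≤-trans (+-monoˡ-≤ (sum xs) (n≤T x)) (T+sum≤T-last xs↑ eq)

T-length≤sum : ∀ c {xs} → Linked _<_ xs → All (c <_) xs → c * length xs + T (length xs) ≤ sum xs
T-length≤sum c {[]}     _   _           = ≤-reflexive (trans (+-identityʳ (c * 0)) (*-zeroʳ c))
T-length≤sum c {x ∷ xs} xs↑ (c<x ∷ _) = begin
  c * suc ℓ + T (suc ℓ)       ≡⟨ rearrange c ℓ (T ℓ) ⟩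
  suc c + (suc c * ℓ + T ℓ)   ≤⟨ +-mono-≤ c<x (T-length≤sum (suc c) (Linked.tail xs↑) (above-c+1 xs↑)) ⟩
  x + sum xs                  ∎
  where
  open ≤-Reasoning
  open +-*-Solver
  ℓ : ℕ
  ℓ = length xs
  rearrange : ∀ c ℓ t → c * suc ℓ + (suc ℓ + t) ≡ suc c + (suc c * ℓ + t)
  rearrange = solve 3 (λ c ℓ t → c :* (con 1 :+ ℓ) :+ ((con 1 :+ ℓ) :+ t)
                             := (con 1 :+ c) :+ ((con 1 :+ c) :* ℓ :+ t)) refl
  above-c+1 : ∀ {ys} → Linked _<_ (x ∷ ys) → All (suc c <_) ys
  above-c+1 [-]         = []
  above-c+1 (x<y ∷ ys↑) = All.map (≤-<-trans c<x) (Linked⇒All <-trans x<y ys↑)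

cover⇒≤length : ∀ {A : Set} {xs : List A} (f : A → ℕ) k →
  (∀ i → i < k → ∃[ x ] x ∈ xs × f x ≡ i) → k ≤ length xs
cover⇒≤length {xs = xs} f k cover = injective⇒≤ position-injective
  where
  position : Fin k → Fin (length xs)
  position i = index (proj₁ (proj₂ (cover (toℕ i) (toℕ<n i))))
  f-at-position : ∀ i → f (lookup xs (position i)) ≡ toℕ i
  f-at-position i with cover (toℕ i) (toℕ<n i)
  ... | x , x∈xs , fx≡i = trans (cong f (sym (lookup-index x∈xs))) fx≡i
  position-injective : Injective _≡_ _≡_ position
  position-injective {i} {j} eq = toℕ-injective (begin
    toℕ i                        ≡⟨ f-at-position i ⟨
    f (lookup xs (position i))   ≡⟨ cong (f ∘ lookup xs) eq ⟩
    f (lookup xs (position j))   ≡⟨ f-at-position j ⟩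
    toℕ j                        ∎)
    where open ≡-Reasoning

nearerEnd : ℕ → ℕ → ℕ
nearerEnd m x = x ⊓ (m ∸ x)

nearerEnd-self : ∀ m → nearerEnd m m ≡ 0
nearerEnd-self m = trans (cong (m ⊓_) (n∸n≡0 m)) (⊓-zeroʳ m)

nearerEnd-lower : ∀ {m a} → a + a ≤ m → nearerEnd m a ≡ a
nearerEnd-lower {m} {a} a+a≤m = m≤n⇒m⊓n≡m (m+n≤o⇒m≤o∸n a a+a≤m)

nearerEnd-upper : ∀ {m a} → a + a ≤ m → nearerEnd m (m ∸ a) ≡ a
nearerEnd-upper {m} {a} a+a≤m = begin
  (m ∸ a) ⊓ (m ∸ (m ∸ a))   ≡⟨ cong ((m ∸ a) ⊓_) (m∸[m∸n]≡n (m+n≤o⇒m≤o a a+a≤m)) ⟩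
  (m ∸ a) ⊓ a               ≡⟨ m≥n⇒m⊓n≡n (m+n≤o⇒m≤o∸n a a+a≤m) ⟩
  a                         ∎
  where open ≡-Reasoning

unrefinable⇒meets-pair : ∀ {xs m} → Unrefinable xs → MaxPart xs m →
  ∀ a → 1 ≤ a → a + a < m → a ∈ xs ⊎ m ∸ a ∈ xs
unrefinable⇒meets-pair {xs} {m} unrefinable max a 1≤a a+a<m with a ∈? xs | m ∸ a ∈? xs
... | yes a∈xs | _          = inj₁ a∈xs
... | no _     | yes b∈xs   = inj₂ b∈xs
... | no a∉xs  | no b∉xs    = contradiction refinement unrefinable
  where
  a≤m : a ≤ m
  a≤m = m+n≤o⇒m≤o a (<⇒≤ a+a<m)
  a<m∸a : a < m ∸ a
  a<m∸a = +-cancelˡ-< a a (m ∸ a) (≤-trans a+a<m (≤-reflexive (sym (m+[n∸m]≡n a≤m))))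
  refinement : Refinable xs
  refinement = m , max , m , a , m ∸ a , last-∈ max
             , (1≤a , a≤m , a∉xs) , (≤-<-trans z≤n a<m∸a , m∸n≤m m a , b∉xs)
             , a<m∸a , sym (m+[n∸m]≡n a≤m)

unrefinable⇒length : ∀ {xs m} → Unrefinable xs → MaxPart xs m →
  ∀ k → k + k < m → suc k ≤ length xs
unrefinable⇒length {xs} {m} unrefinable max k k+k<m = cover⇒≤length (nearerEnd m) (suc k) cover
  where
  cover : ∀ i → i < suc k → ∃[ x ] x ∈ xs × nearerEnd m x ≡ i
  cover zero    _         = m , last-∈ max , nearerEnd-self m
  cover (suc a) (s≤s a<k) = choose (unrefinable⇒meets-pair unrefinable max (suc a) (s≤s z≤n) a+a<m)
    where
    a+a<m : suc a + suc a < m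
    a+a<m = ≤-<-trans (+-mono-≤ a<k a<k) k+k<m
    choose : suc a ∈ xs ⊎ m ∸ suc a ∈ xs → ∃[ x ] x ∈ xs × nearerEnd m x ≡ suc a
    choose (inj₁ a∈xs) = suc a , a∈xs , nearerEnd-lower (<⇒≤ a+a<m)
    choose (inj₂ b∈xs) = m ∸ suc a , b∈xs , nearerEnd-upper (<⇒≤ a+a<m)

proposition3p2 : (N n : ℕ) → 1 ≤ n → T (n ∸ 1) < N → N < T n →
    (P : DistinctPartition N) → Unrefinable (DistinctPartition.parts P) →
    (m : ℕ) → MaxPart (DistinctPartition.parts P) m →
    (n ≤ m) × (m ≤ 2 * n ∸ 2)
proposition3p2 N (suc k) _ T[k]<N N<T[n] P unrefinable m max = n≤m , m≤2n-2
  where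
  open DistinctPartition P
  open ≤-Reasoning
  n≤m : suc k ≤ m
  n≤m = ≮⇒≥ λ m<n → <⇒≱ T[k]<N (begin
    N           ≡⟨ sumIsN ⟨
    sum parts   ≤⟨ sum≤T-last increasing max ⟩
    T m         ≤⟨ T-mono-≤ (s≤s⁻¹ m<n) ⟩
    T k         ∎)
  2n-2≡k+k : 2 * suc k ∸ 2 ≡ k + k
  2n-2≡k+k = trans (cong (_∸ 2) (*-suc 2 k)) (cong (k +_) (+-identityʳ k))
  m≤2n-2 : m ≤ 2 * suc k ∸ 2
  m≤2n-2 = subst (m ≤_) (sym 2n-2≡k+k) (≮⇒≥ λ k+k<m → <⇒≱ N<T[n] (begin
    T (suc k)          ≤⟨ T-mono-≤ (unrefinable⇒length unrefinable max k k+k<m) ⟩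
    T (length parts)   ≤⟨ T-length≤sum 0 increasing positive ⟩
    sum parts          ≡⟨ sumIsN ⟩
    N                  ∎))
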